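{- Let $0<p<1$ and let $E \subseteq \binom{[n]}{2}$ be a nonempty set of potential edges. Then for every graph $G$ on $[n]$, \[ \sum_{\emptyset\neq E' \subseteq E}\left(\sqrt{\frac{p}{1-p}}\right)^{|E'|}\chi_{E'}(G) = \sum_{e \in E}\sqrt{\frac{p}{1-p}}\,\chi_{\{e\}}(G)\sum_{E' \subseteq E \setminus \{e\}}\frac{1}{|E|\binom{|E|-1}{|E'|}}\left(\frac{1}{1-p}\right)^{|E'|}\mathbf{1}_{\forall e' \in E':\ e' \notin E(G)}. \]
   Context: A graph $G$ on $[n]$ is identified with $G\in\{0,1\}^{\binom{[n]}{2}}$ ($G_e=1$ iff $e\in E(G)$). The $p$-biased character is $\chi(0)=\sqrt{p/(1-p)}$, $\chi(1)=-\sqrt{(1-p)/p}$, and $\chi_H(G)=\prod_{e\in H}\chi(G_e)$ for $H\subseteq\binom{[n]}{2}$. -}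

module Defs where

open import Level using (Level)
open import Data.Bool using (Bool; true; false)
open import Data.Nat using (ℕ; zero; suc; NonZero)
open import Data.Fin using (Fin; _<_)
open import Data.Product using (Σ; _×_; _,_)
open import Data.List using (List; []; _∷_; map; _++_; foldr; length)
open import Algebra.Bundles using (CommutativeRing)

-- Potential edges of a graph on [n]: pairs {i,j} encoded as i < j.
Edge : ℕ → Set
Edge n = Σ (Fin n) λ i → Σ (Fin n) λ j → i < j

-- A graph on [n] as an element of {0,1}^{binom([n],2)}: G e = true iff e ∈ E(G).
Graph : ℕ → Set
Graph n = Edge n → Bool

subsets⁺ : ∀ {a} {A : Set a} → List A → List (List A)
subsets⁺ []       = []
subsets⁺ (x ∷ xs) = (x ∷ []) ∷ (map (x ∷_) (subsets⁺ xs) ++ subsets⁺ xs)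

subsets : ∀ {a} {A : Set a} → List A → List (List A)
subsets xs = [] ∷ subsets⁺ xs

-- Each element e of a list together with the list with that occurrence removed
-- (for a duplicate-free list: the pairs (e , E ∖ {e}) for e ∈ E).
picks : ∀ {a} {A : Set a} → List A → List (A × List A)
picks []       = []
picks (x ∷ xs) = (x , xs) ∷ map (λ { (y , ys) → (y , x ∷ ys) }) (picks xs)

module _ {c ℓ : Level} (R : CommutativeRing c ℓ) where
  open CommutativeRing R

  Σl : List Carrier → Carrier
  Σl = foldr _+_ 0#

  Πl : List Carrier → Carrier
  Πl = foldr _*_ 1#

  pow : Carrier → ℕ → Carrier
  pow x zero    = 1#
  pow x (suc k) = x * pow x k

  fromℕ : ℕ → Carrier
  fromℕ zero    = 0#
  fromℕ (suc k) = 1# + fromℕ k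

  -- p-biased character, with s = sqrt(p/(1-p)) and t = sqrt((1-p)/p):
  -- χ(0) = s, χ(1) = - t   (Bool: false = 0, true = 1)
  χ : (s t : Carrier) → Bool → Carrier
  χ s t false = s
  χ s t true  = - t

  χ[_] : ∀ {n} → (s t : Carrier) → List (Edge n) → Graph n → Carrier
  χ[_] s t H G = Πl (map (λ e → χ s t (G e)) H)

  noEdgeIn : ∀ {n} → List (Edge n) → Graph n → Carrier
  noEdgeIn []       G = 1#
  noEdgeIn (e ∷ es) G with G e
  ... | true  = 0#
  ... | false = noEdgeIn es G

-- Write ε e = s·χ(G e): it is s·s = u − 1 on a non-edge and −1 on an edge. Expanding the product,
-- the left-hand side plus one is ∏_{e ∈ E} (1 + ε e), which is u^{|E|} if E contains no edge of G
-- and 0 otherwise. On the right, the inner sum for e depends only on the number of non-edges of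
-- E ∖ {e}: it is B(m) = Σ_j C(m, j) c_j u^j with c_j = 1 / (|E| C(|E| − 1, j)). With m non-edges and
-- t edges in E the right-hand side is therefore s·s·m·B(m − 1) − t·B(m). The weights satisfy
-- j·c_{j−1} = (|E| − j)·c_j, so the coefficients of u^j telescope. To run this as an induction on m,
-- shift the weights by a: the resulting family Λ(a, m) obeys the same Pascal recursion as r·B(a, m),
-- so the two differ only by boundary terms, −1 at a = 0 and u^m at r = 0 (that is, t = 0).
module Submission where

open import Defs
open import Level using (Level)
open import Data.Nat using (ℕ; zero; suc; NonZero; _∸_; _*_)
open import Data.Nat.Combinatorics using (_C_; nCn≡1)
open import Data.List using (List; []; _∷_; map; length; _++_)
open import Data.Product using (_×_; _,_)
open import Data.List.Relation.Unary.Unique.Propositional using (Unique)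
open import Relation.Binary.PropositionalEquality using (_≢_)
open import Algebra.Bundles using (CommutativeRing)

import Data.Nat as Nat
import Data.Nat.Properties as Natₚ
open import Data.Bool using (Bool; true; false; if_then_else_)
open import Data.List.Properties using (map-++; map-∘)
open import Function using (_∘_)
open import Relation.Binary.PropositionalEquality as ≡ using (_≡_)

module BinomialCoefficients where
  open Nat
  open Natₚ
  open import Data.Nat.Combinatorics
  open ≡ using (refl; cong; sym; trans; subst)

  0<nCk : ∀ {n k} → k ≤ n → 0 < n C k
  0<nCk {n}     {zero}  _         = z<s
  0<nCk {suc n} {suc k} (s≤s k≤n) = subst (0 <_) (nCk+nC[k+1]≡[n+1]C[k+1] n k)
    (<-≤-trans (0<nCk k≤n) (m≤m+n (n C k) (n C suc k)))

  [k+1]*[k+r]C[k+1]≡r*[k+r]Ck : ∀ k r → suc k * ((k + r) C suc k) ≡ r * ((k + r) C k)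
  [k+1]*[k+r]C[k+1]≡r*[k+r]Ck k zero =
    trans (cong (suc k *_) (k>n⇒nCk≡0 (subst (_< suc k) (sym (+-identityʳ k)) (n<1+n k)))) (*-zeroʳ (suc k))
  [k+1]*[k+r]C[k+1]≡r*[k+r]Ck zero (suc r) =
    trans (+-identityʳ (suc r C 1)) (trans (nC1≡n (suc r)) (sym (*-identityʳ (suc r))))
  [k+1]*[k+r]C[k+1]≡r*[k+r]Ck (suc k) (suc r) = begin
    (2 + k) * (suc N C (2 + k))
      ≡⟨ cong ((2 + k) *_) (nCk+nC[k+1]≡[n+1]C[k+1] N (suc k)) ⟨
    (2 + k) * (B + N C (2 + k))
      ≡⟨ *-distribˡ-+ (2 + k) B _ ⟩
    (2 + k) * B + (2 + k) * (N C (2 + k))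
      ≡⟨ cong (λ n → (2 + k) * B + (2 + k) * (n C (2 + k))) (+-suc k r) ⟩
    (2 + k) * B + (2 + k) * ((suc k + r) C (2 + k))
      ≡⟨ cong ((2 + k) * B +_) ([k+1]*[k+r]C[k+1]≡r*[k+r]Ck (suc k) r) ⟩
    (2 + k) * B + r * ((suc k + r) C suc k)
      ≡⟨ cong (λ n → (2 + k) * B + r * (n C suc k)) (+-suc k r) ⟨
    (2 + k) * B + r * B
      ≡⟨ solve 3 (λ k r b → (con 2 :+ k) :* b :+ r :* b := (con 1 :+ k) :* b :+ (con 1 :+ r) :* b) refl k r B ⟩
    suc k * B + suc r * B
      ≡⟨ cong (_+ suc r * B) ([k+1]*[k+r]C[k+1]≡r*[k+r]Ck k (suc r)) ⟩
    suc r * A + suc r * B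
      ≡⟨ *-distribˡ-+ (suc r) A B ⟨
    suc r * (A + B)
      ≡⟨ cong (suc r *_) (nCk+nC[k+1]≡[n+1]C[k+1] N k) ⟩
    suc r * (suc N C suc k) ∎
    where
    open ≡.≡-Reasoning
    open import Data.Nat.Solver using (module +-*-Solver)
    open +-*-Solver using (solve; _:=_; _:+_; _:*_; con)
    N = k + suc r
    A = N C k
    B = N C suc k

module GraphCounts {n : ℕ} (G : Graph n) where
  open Nat using (_+_)

  nonEdges edges : List (Edge n) → ℕ
  nonEdges []       = 0
  nonEdges (e ∷ es) = if G e then nonEdges es else suc (nonEdges es)
  edges    []       = 0
  edges    (e ∷ es) = if G e then suc (edges es) else edges es

  nonEdges+edges : ∀ L → nonEdges L + edges L ≡ length L
  nonEdges+edges []       = ≡.refl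
  nonEdges+edges (e ∷ es) with G e
  ... | true  = ≡.trans (Natₚ.+-suc (nonEdges es) (edges es)) (≡.cong suc (nonEdges+edges es))
  ... | false = ≡.cong suc (nonEdges+edges es)

module _ {c ℓ : Level} (R : CommutativeRing c ℓ) where
  open CommutativeRing R renaming (_*_ to _·_)
  open import Algebra.Solver.Ring.NaturalCoefficients.Default commutativeSemiring
  open import Relation.Binary.Reasoning.Setoid setoid
  open import Algebra.Properties.Group +-group using (∙-cancelʳ)
  open import Algebra.Properties.Ring ring using (-‿distribʳ-*; -1*x≈-x)
  import Algebra.Properties.Semiring.Mult semiring as Mult

  private variable
    ℓ′ : Level
    A : Set ℓ′

  Σl-++ : ∀ xs ys → Σl R (xs ++ ys) ≈ Σl R xs + Σl R ys
  Σl-++ []       ys = sym (+-identityˡ _)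
  Σl-++ (x ∷ xs) ys = trans (+-congˡ (Σl-++ xs ys)) (sym (+-assoc _ _ _))

  Σl-cong : ∀ {f g : A → Carrier} → (∀ x → f x ≈ g x) → ∀ xs → Σl R (map f xs) ≈ Σl R (map g xs)
  Σl-cong f≈g []       = refl
  Σl-cong f≈g (x ∷ xs) = +-cong (f≈g x) (Σl-cong f≈g xs)

  Σl-zero : ∀ {f : A → Carrier} → (∀ x → f x ≈ 0#) → ∀ xs → Σl R (map f xs) ≈ 0#
  Σl-zero f≈0 []       = refl
  Σl-zero f≈0 (x ∷ xs) = trans (+-cong (f≈0 x) (Σl-zero f≈0 xs)) (+-identityˡ 0#)

  Σl-*ˡ : ∀ a (f : A → Carrier) xs → Σl R (map (λ x → a · f x) xs) ≈ a · Σl R (map f xs)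
  Σl-*ˡ a f []       = sym (zeroʳ a)
  Σl-*ˡ a f (x ∷ xs) = trans (+-congˡ (Σl-*ˡ a f xs)) (sym (distribˡ a _ _))

  Σl-subsets-∷ : ∀ (f : List A → Carrier) x xs →
    Σl R (map f (subsets (x ∷ xs))) ≈ Σl R (map f (subsets xs)) + Σl R (map (f ∘ (x ∷_)) (subsets xs))
  Σl-subsets-∷ f x xs = begin
    f [] + (f (x ∷ []) + Σl R (map f (map (x ∷_) (subsets⁺ xs) ++ subsets⁺ xs)))
      ≡⟨ ≡.cong (λ l → f [] + (f (x ∷ []) + Σl R l))
           (≡.trans (map-++ f _ (subsets⁺ xs)) (≡.cong (_++ _) (≡.sym (map-∘ (subsets⁺ xs))))) ⟩
    f [] + (f (x ∷ []) + Σl R (map (f ∘ (x ∷_)) (subsets⁺ xs) ++ map f (subsets⁺ xs)))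
      ≈⟨ +-congˡ (+-congˡ (Σl-++ (map (f ∘ (x ∷_)) (subsets⁺ xs)) (map f (subsets⁺ xs)))) ⟩
    f [] + (f (x ∷ []) + (P + Q))
      ≈⟨ solve 4 (λ a b p q → a :+ (b :+ (p :+ q)) := (a :+ q) :+ (b :+ p)) refl (f []) (f (x ∷ [])) P Q ⟩
    (f [] + Q) + (f (x ∷ []) + P) ∎
    where
    P = Σl R (map (f ∘ (x ∷_)) (subsets⁺ xs))
    Q = Σl R (map f (subsets⁺ xs))

  Σl-subsets-Πl : ∀ (h : A → Carrier) xs →
    Σl R (map (λ S → Πl R (map h S)) (subsets xs)) ≈ Πl R (map (λ x → 1# + h x) xs)
  Σl-subsets-Πl h []       = +-identityʳ 1#
  Σl-subsets-Πl h (x ∷ xs) = begin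
    Σl R (map Πh (subsets (x ∷ xs)))
      ≈⟨ Σl-subsets-∷ Πh x xs ⟩
    Σl R (map Πh (subsets xs)) + Σl R (map (λ S → h x · Πh S) (subsets xs))
      ≈⟨ +-congˡ (Σl-*ˡ (h x) Πh (subsets xs)) ⟩
    P + h x · P
      ≈⟨ solve 2 (λ p e → p :+ e :* p := (con 1 :+ e) :* p) refl P (h x) ⟩
    (1# + h x) · P
      ≈⟨ *-congˡ (Σl-subsets-Πl h xs) ⟩
    Πl R (map (λ x → 1# + h x) (x ∷ xs)) ∎
    where
    Πh = λ S → Πl R (map h S)
    P = Σl R (map Πh (subsets xs))

  pow-Πl : ∀ (g : A → Carrier) x xs → pow R x (length xs) · Πl R (map g xs) ≈ Πl R (map (λ e → x · g e) xs)
  pow-Πl g x []       = *-identityʳ 1#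
  pow-Πl g x (y ∷ xs) = trans
    (solve 4 (λ x p a b → (x :* p) :* (a :* b) := (x :* a) :* (p :* b)) refl x (pow R x (length xs)) (g y) (Πl R (map g xs)))
    (*-congˡ (pow-Πl g x xs))

  fromℕ≈×1 : ∀ m → fromℕ R m ≈ m Mult.× 1#
  fromℕ≈×1 zero    = refl
  fromℕ≈×1 (suc m) = +-congˡ (fromℕ≈×1 m)

  fromℕ-* : ∀ m n → fromℕ R (m * n) ≈ fromℕ R m · fromℕ R n
  fromℕ-* m n = trans (fromℕ≈×1 (m * n)) (trans (Mult.×1-homo-* m n) (sym (*-cong (fromℕ≈×1 m) (fromℕ≈×1 n))))

  cross-multiply : ∀ x y N₁ N₂ {c₁ c₂} → fromℕ R N₁ · c₁ ≈ 1# → fromℕ R N₂ · c₂ ≈ 1# →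
    x * N₂ ≡ y * N₁ → fromℕ R x · c₁ ≈ fromℕ R y · c₂
  cross-multiply x y N₁ N₂ {c₁} {c₂} N₁c₁≈1 N₂c₂≈1 xN₂≡yN₁ = begin
    F x · c₁                 ≈⟨ *-identityʳ _ ⟨
    F x · c₁ · 1#            ≈⟨ *-congˡ N₂c₂≈1 ⟨
    F x · c₁ · (F N₂ · c₂)   ≈⟨ solve 4 (λ x c n d → x :* c :* (n :* d) := x :* n :* c :* d) refl (F x) c₁ (F N₂) c₂ ⟩
    F x · F N₂ · c₁ · c₂     ≈⟨ *-congʳ (*-congʳ (trans (sym (fromℕ-* x N₂)) (trans xN₂≈yN₁ (fromℕ-* y N₁)))) ⟩
    F y · F N₁ · c₁ · c₂     ≈⟨ solve 4 (λ y n c d → y :* n :* c :* d := y :* d :* (n :* c)) refl (F y) (F N₁) c₁ c₂ ⟩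
    F y · c₂ · (F N₁ · c₁)   ≈⟨ *-congˡ N₁c₁≈1 ⟩
    F y · c₂ · 1#            ≈⟨ *-identityʳ _ ⟩
    F y · c₂                 ∎
    where
    F = fromℕ R
    xN₂≈yN₁ = reflexive (≡.cong F xN₂≡yN₁)

  𝟙[_≡0] : ℕ → Carrier
  𝟙[ zero  ≡0] = 1#
  𝟙[ suc _ ≡0] = 0#

  timesPred : (ℕ → Carrier) → ℕ → Carrier
  timesPred φ zero    = 0#
  timesPred φ (suc m) = fromℕ R (suc m) · φ m

  timesPred-∘suc : ∀ φ m → φ m + timesPred (φ ∘ suc) m ≈ timesPred φ (suc m)
  timesPred-∘suc φ zero    = solve 1 (λ p → p :+ con 0 := (con 1 :+ con 0) :* p) refl (φ 0)
  timesPred-∘suc φ (suc m) = solve 2 (λ k p → p :+ k :* p := (con 1 :+ k) :* p) refl (fromℕ R (suc m)) (φ (suc m))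

  module BinomialSums (u : Carrier) where

    -- binomialSum f a m = Σ_{j ≤ m} C(m, j) · f (a + j) · u^j
    binomialSum : (ℕ → Carrier) → ℕ → ℕ → Carrier
    binomialSum f a zero    = f a
    binomialSum f a (suc m) = binomialSum f a m + u · binomialSum f (suc a) m

    timesPred-binomialSum : ∀ f a m →
      timesPred (binomialSum f a) m + u · timesPred (binomialSum f (suc a)) m ≈ fromℕ R m · binomialSum f a m
    timesPred-binomialSum f a zero    = solve 2 (λ u b → con 0 :+ u :* con 0 := con 0 :* b) refl u (f a)
    timesPred-binomialSum f a (suc m) =
      solve 4 (λ k u b b′ → k :* b :+ u :* (k :* b′) := k :* (b :+ u :* b′)) refl
        (fromℕ R (suc m)) u (binomialSum f a m) (binomialSum f (suc a) m)

  module GraphSums {n : ℕ} (G : Graph n) (s t u : Carrier) (s·t≈1 : s · t ≈ 1#) (u≈1+s·s : u ≈ 1# + s · s) where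
    open BinomialSums u
    open GraphCounts G

    sχ[true]≈-1 : s · χ R s t true ≈ - 1#
    sχ[true]≈-1 = trans (sym (-‿distribʳ-* s t)) (-‿cong s·t≈1)

    sχ[true]x+x≈0 : ∀ x → s · χ R s t true · x + x ≈ 0#
    sχ[true]x+x≈0 x = trans (+-congʳ (trans (*-congʳ sχ[true]≈-1) (-1*x≈-x x))) (-‿inverseˡ x)

    1+sχ[true]≈0 : 1# + s · χ R s t true ≈ 0#
    1+sχ[true]≈0 = trans (+-congˡ sχ[true]≈-1) (-‿inverseʳ 1#)

    Πl-1+sχ : ∀ L → Πl R (map (λ e → 1# + s · χ R s t (G e)) L) ≈ 𝟙[ edges L ≡0] · pow R u (nonEdges L)
    Πl-1+sχ []       = sym (*-identityˡ 1#)
    Πl-1+sχ (e ∷ es) with G e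
    ... | true  = trans (*-congʳ 1+sχ[true]≈0) (trans (zeroˡ _) (sym (zeroˡ _)))
    ... | false = trans (*-cong (sym u≈1+s·s) (Πl-1+sχ es))
      (solve 3 (λ u i p → u :* (i :* p) := i :* (u :* p)) refl u 𝟙[ edges es ≡0] (pow R u (nonEdges es)))

    Σl-subsets-sχ : ∀ L → Σl R (map (λ S → pow R s (length S) · χ[_] R s t S G) (subsets L))
                          ≈ 𝟙[ edges L ≡0] · pow R u (nonEdges L)
    Σl-subsets-sχ L = begin
      Σl R (map (λ S → pow R s (length S) · χ[_] R s t S G) (subsets L))
        ≈⟨ Σl-cong (λ S → pow-Πl (λ e → χ R s t (G e)) s S) (subsets L) ⟩
      Σl R (map (λ S → Πl R (map (λ e → s · χ R s t (G e)) S)) (subsets L))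
        ≈⟨ Σl-subsets-Πl (λ e → s · χ R s t (G e)) L ⟩
      Πl R (map (λ e → 1# + s · χ R s t (G e)) L)
        ≈⟨ Πl-1+sχ L ⟩
      𝟙[ edges L ≡0] · pow R u (nonEdges L) ∎

    noEdgeTerm : (ℕ → Carrier) → ℕ → List (Edge n) → Carrier
    noEdgeTerm f a S = f (a Nat.+ length S) · pow R u (length S) · noEdgeIn R S G

    noEdgeTerm-∷ : ∀ f a x S → noEdgeTerm f a (x ∷ S) ≈ (if G x then 0# else u · noEdgeTerm f (suc a) S)
    noEdgeTerm-∷ f a x S with G x
    ... | true  = zeroʳ _
    ... | false rewrite Natₚ.+-suc a (length S) =
      solve 4 (λ c u p e → c :* (u :* p) :* e := u :* (c :* p :* e)) refl
        (f (suc (a Nat.+ length S))) u (pow R u (length S)) (noEdgeIn R S G)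

    Σl-subsets-noEdgeTerm : ∀ f a L → Σl R (map (noEdgeTerm f a) (subsets L)) ≈ binomialSum f a (nonEdges L)
    Σl-subsets-noEdgeTerm f a []       = trans (+-identityʳ _)
      (trans (*-identityʳ _) (trans (*-identityʳ _) (reflexive (≡.cong f (Natₚ.+-identityʳ a)))))
    Σl-subsets-noEdgeTerm f a (x ∷ xs) = begin
      Σl R (map (noEdgeTerm f a) (subsets (x ∷ xs)))
        ≈⟨ Σl-subsets-∷ (noEdgeTerm f a) x xs ⟩
      Σl R (map (noEdgeTerm f a) (subsets xs)) + Σl R (map (noEdgeTerm f a ∘ (x ∷_)) (subsets xs))
        ≈⟨ +-cong (Σl-subsets-noEdgeTerm f a xs) (Σl-cong (noEdgeTerm-∷ f a x) (subsets xs)) ⟩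
      binomialSum f a m + Σl R (map (λ S → if G x then 0# else u · noEdgeTerm f (suc a) S) (subsets xs))
        ≈⟨ byStatus (G x) ⟩
      binomialSum f a (nonEdges (x ∷ xs)) ∎
      where
      m = nonEdges xs
      byStatus : ∀ b → binomialSum f a m + Σl R (map (λ S → if b then 0# else u · noEdgeTerm f (suc a) S) (subsets xs))
                       ≈ binomialSum f a (if b then m else suc m)
      byStatus true  = trans (+-congˡ (Σl-zero (λ _ → refl) (subsets xs))) (+-identityʳ _)
      byStatus false = +-congˡ (trans (Σl-*ˡ u (noEdgeTerm f (suc a)) (subsets xs))
                                      (*-congˡ (Σl-subsets-noEdgeTerm f (suc a) xs)))

    pickTerm : (ℕ → Carrier) → Edge n × List (Edge n) → Carrier
    pickTerm φ (e , r) = s · χ R s t (G e) · φ (nonEdges r)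

    Σl-picks : ∀ φ L → Σl R (map (pickTerm φ) (picks L)) + fromℕ R (edges L) · φ (nonEdges L)
                       ≈ s · s · timesPred φ (nonEdges L)
    Σl-picks φ []       = solve 3 (λ p s z → con 0 :+ con 0 :* p := s :* s :* con 0) refl (φ 0) s 0#
    Σl-picks φ (x ∷ xs) = begin
      Σl R (map (pickTerm φ) (picks (x ∷ xs))) + T′ · φ (nonEdges (x ∷ xs))
        ≡⟨ ≡.cong (λ l → pickTerm φ (x , xs) + Σl R l + T′ · φ (nonEdges (x ∷ xs))) (≡.sym (map-∘ (picks xs))) ⟩
      pickTerm φ (x , xs) + Σl R (map (pickTerm (φ ∘ bump (G x))) (picks xs)) + T′ · φ (nonEdges (x ∷ xs))
        ≈⟨ byStatus (G x) ⟩
      s · s · timesPred φ (nonEdges (x ∷ xs)) ∎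
      where
      m = nonEdges xs
      T = fromℕ R (edges xs)
      T′ = fromℕ R (edges (x ∷ xs))
      bump : Bool → ℕ → ℕ
      bump b k = if b then k else suc k
      byStatus : ∀ b → s · χ R s t b · φ m + Σl R (map (pickTerm (φ ∘ bump b)) (picks xs))
                         + fromℕ R (if b then suc (edges xs) else edges xs) · φ (bump b m)
                       ≈ s · s · timesPred φ (bump b m)
      byStatus true  = begin
        s · χ R s t true · φ m + S + (1# + T) · φ m
          ≈⟨ solve 4 (λ e p S T → e :+ S :+ (con 1 :+ T) :* p := (e :+ p) :+ (S :+ T :* p)) refl
               (s · χ R s t true · φ m) (φ m) S T ⟩
        (s · χ R s t true · φ m + φ m) + (S + T · φ m)
          ≈⟨ +-cong (sχ[true]x+x≈0 (φ m)) (Σl-picks φ xs) ⟩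
        0# + s · s · timesPred φ m
          ≈⟨ +-identityˡ _ ⟩
        s · s · timesPred φ m ∎
        where S = Σl R (map (pickTerm φ) (picks xs))
      byStatus false = begin
        s · s · φ m + S + T · φ (suc m)                ≈⟨ +-assoc _ _ _ ⟩
        s · s · φ m + (S + T · φ (suc m))              ≈⟨ +-congˡ (Σl-picks (φ ∘ suc) xs) ⟩
        s · s · φ m + s · s · timesPred (φ ∘ suc) m    ≈⟨ distribˡ _ _ _ ⟨
        s · s · (φ m + timesPred (φ ∘ suc) m)          ≈⟨ *-congˡ (timesPred-∘suc φ m) ⟩
        s · s · timesPred φ (suc m)                    ∎
        where S = Σl R (map (pickTerm (φ ∘ suc)) (picks xs))

  module Telescoping (u v : Carrier) (u≈1+v : u ≈ 1# + v) where
    open BinomialSums u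

    -- Λ f 0 m = v·m·B(0, m − 1) is what the right-hand side becomes after adding t·B(0, m). For a ≥ 1
    -- the extra summand a·B(a − 1, m) makes Λ obey the same recursion as r·B(a, m); at a = 0 it is 0.
    Λ : (ℕ → Carrier) → ℕ → ℕ → Carrier
    Λ f a m = fromℕ R a · binomialSum f (Nat.pred a) m + v · timesPred (binomialSum f a) m

    correction : ℕ → ℕ → ℕ → Carrier
    correction a m r = 𝟙[ a ≡0] · (- 1#) + 𝟙[ r ≡0] · pow R u m

    pred-binomialSum : ∀ f a m → fromℕ R a · binomialSum f (Nat.pred a) (suc m)
                                 ≈ fromℕ R a · binomialSum f (Nat.pred a) m + u · (fromℕ R a · binomialSum f a m)
    pred-binomialSum f zero    m = solve 4 (λ x y u z → con 0 :* x := con 0 :* y :+ u :* (con 0 :* z)) refl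
      (binomialSum f 0 (suc m)) (binomialSum f 0 m) u (binomialSum f 0 m)
    pred-binomialSum f (suc a) m = solve 4 (λ k x u y → k :* (x :+ u :* y) := k :* x :+ u :* (k :* y)) refl
      (fromℕ R (suc a)) (binomialSum f a m) u (binomialSum f (suc a) m)

    Λ-rec : ∀ f a m → Λ f a (suc m) + binomialSum f a m ≈ Λ f a m + u · Λ f (suc a) m
    Λ-rec f a m = begin
      Λ f a (suc m) + B
        ≈⟨ +-congʳ (+-congʳ (pred-binomialSum f a m)) ⟩
      (F a · B⁻ + u · (F a · B)) + v · ((1# + F m) · B) + B
        ≈⟨ solve 6 (λ p u fa b v fm → (fa :* p :+ u :* (fa :* b)) :+ v :* ((con 1 :+ fm) :* b) :+ b
                                   := fa :* p :+ (u :* (fa :* b) :+ (con 1 :+ v) :* b) :+ v :* (fm :* b))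
             refl B⁻ u (F a) B v (F m) ⟩
      F a · B⁻ + (u · (F a · B) + (1# + v) · B) + v · (F m · B)
        ≈⟨ +-cong (+-congˡ (+-congˡ (*-congʳ (sym u≈1+v)))) (*-congˡ (sym (timesPred-binomialSum f a m))) ⟩
      F a · B⁻ + (u · (F a · B) + u · B) + v · (D + u · D′)
        ≈⟨ solve 7 (λ p u fa b v d d′ → fa :* p :+ (u :* (fa :* b) :+ u :* b) :+ v :* (d :+ u :* d′)
                                     := fa :* p :+ v :* d :+ u :* ((con 1 :+ fa) :* b :+ v :* d′))
             refl B⁻ u (F a) B v D D′ ⟩
      Λ f a m + u · Λ f (suc a) m ∎
      where
      F = fromℕ R
      B = binomialSum f a m
      B⁻ = binomialSum f (Nat.pred a) m
      D = timesPred (binomialSum f a) m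
      D′ = timesPred (binomialSum f (suc a)) m

    fromℕ·binomialSum-rec : ∀ f a m r → fromℕ R r · binomialSum f a (suc m) + binomialSum f a m
                                         ≈ fromℕ R (suc r) · binomialSum f a m + u · (fromℕ R r · binomialSum f (suc a) m)
    fromℕ·binomialSum-rec f a m r =
      solve 4 (λ k b u b′ → k :* (b :+ u :* b′) :+ b := (con 1 :+ k) :* b :+ u :* (k :* b′)) refl
        (fromℕ R r) (binomialSum f a m) u (binomialSum f (suc a) m)

    correction-rec : ∀ a m r → correction a (suc m) r ≈ correction a m (suc r) + u · correction (suc a) m r
    correction-rec a m r =
      solve 5 (λ i n j u p → i :* n :+ j :* (u :* p) := i :* n :+ con 0 :* p :+ u :* (con 0 :* n :+ j :* p)) refl
        𝟙[ a ≡0] (- 1#) 𝟙[ r ≡0] u (pow R u m)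

    offset-rec : ∀ {x₁ x₀ x₀′ y₁ y₀ y₀′ z d₁ d₀ d₀′} →
      x₁ + z ≈ x₀ + u · x₀′ → y₁ + z ≈ y₀ + u · y₀′ → d₁ ≈ d₀ + u · d₀′ →
      x₀ ≈ y₀ + d₀ → x₀′ ≈ y₀′ + d₀′ → x₁ ≈ y₁ + d₁
    offset-rec {x₁} {x₀} {x₀′} {y₁} {y₀} {y₀′} {z} {d₁} {d₀} {d₀′} x-rec y-rec d-rec x₀≈ x₀′≈ =
      ∙-cancelʳ z x₁ (y₁ + d₁) (begin
        x₁ + z                           ≈⟨ x-rec ⟩
        x₀ + u · x₀′                     ≈⟨ +-cong x₀≈ (*-congˡ x₀′≈) ⟩
        (y₀ + d₀) + u · (y₀′ + d₀′)      ≈⟨ solve 5 (λ y d u y′ d′ → (y :+ d) :+ u :* (y′ :+ d′)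
                                                                  := (y :+ u :* y′) :+ (d :+ u :* d′))
                                              refl y₀ d₀ u y₀′ d₀′ ⟩
        (y₀ + u · y₀′) + (d₀ + u · d₀′)  ≈⟨ +-cong (sym y-rec) (sym d-rec) ⟩
        (y₁ + z) + d₁                    ≈⟨ solve 3 (λ y z d → y :+ z :+ d := y :+ d :+ z) refl y₁ z d₁ ⟩
        (y₁ + d₁) + z                    ∎)

    module Weights (inv : ℕ → Carrier) (inv-correct : ∀ m → NonZero m → fromℕ R m · inv m ≈ 1#) where
      open BinomialCoefficients

      -- The coefficient 1 / (|E| · C(|E| − 1, i)) of the theorem, for |E| = suc K.
      weight : ℕ → ℕ → Carrier
      weight K i = inv (suc K * (K C i))

      weight-inverse : ∀ K {i} → i Nat.≤ K → fromℕ R (suc K * (K C i)) · weight K i ≈ 1#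
      weight-inverse K {i} i≤K = inv-correct _ (Natₚ.m*n≢0 (suc K) (K C i))
        where instance _ = Nat.>-nonZero (0<nCk i≤K)

      weight-first : ∀ K → fromℕ R (suc K) · weight K 0 ≈ 1#
      weight-first K = trans (*-congʳ (reflexive (≡.cong (fromℕ R) (≡.sym (Natₚ.*-identityʳ (suc K))))))
        (weight-inverse K Nat.z≤n)

      weight-last : ∀ {K b} → b ≡ K → fromℕ R (suc b) · weight K b ≈ 1#
      weight-last {K} ≡.refl = trans (*-congʳ (reflexive (≡.cong (fromℕ R) [K+1]≡[K+1]*KCK)))
        (weight-inverse K Natₚ.≤-refl)
        where
        [K+1]≡[K+1]*KCK : suc K ≡ suc K * (K C K)
        [K+1]≡[K+1]*KCK = ≡.sym (≡.trans (≡.cong (suc K *_) (nCn≡1 K)) (Natₚ.*-identityʳ (suc K)))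

      weight-ratio : ∀ b r → fromℕ R (suc b) · weight (b Nat.+ suc r) b
                             ≈ fromℕ R (suc r) · weight (b Nat.+ suc r) (suc b)
      weight-ratio b r = cross-multiply (suc b) (suc r) (N b) (N (suc b))
        (weight-inverse K (Natₚ.m≤m+n b (suc r))) (weight-inverse K (Natₚ.m<m+n b Nat.z<s))
        (≡.trans (x∙yz≈y∙xz (suc b) (suc K) (K C suc b))
          (≡.trans (≡.cong (suc K *_) ([k+1]*[k+r]C[k+1]≡r*[k+r]Ck b (suc r))) (x∙yz≈y∙xz (suc K) (suc r) (K C b))))
        where
        open import Algebra.Properties.CommutativeSemigroup Natₚ.*-commutativeSemigroup using (x∙yz≈y∙xz)
        K = b Nat.+ suc r
        N = λ i → suc K * (K C i)

      Λ-base : ∀ K a r → a Nat.+ r ≡ suc K → Λ (weight K) a 0 ≈ fromℕ R r · weight K a + correction a 0 r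
      Λ-base K zero .(suc K) ≡.refl = begin
        0# · weight K 0 + v · 0#
          ≈⟨ solve 2 (λ w v → con 0 :* w :+ v :* con 0 := con 0) refl (weight K 0) v ⟩
        0#
          ≈⟨ -‿inverseʳ 1# ⟨
        1# + - 1#
          ≈⟨ solve 2 (λ e n → e :+ n := e :+ (con 1 :* n :+ con 0 :* con 1)) refl 1# (- 1#) ⟩
        1# + (1# · - 1# + 0# · 1#)
          ≈⟨ +-congʳ (weight-first K) ⟨
        fromℕ R (suc K) · weight K 0 + correction 0 0 (suc K) ∎
      Λ-base K (suc b) zero b+1+0≡K+1 = begin
        fromℕ R (suc b) · weight K b + v · 0#
          ≈⟨ +-cong (weight-last b≡K) (zeroʳ v) ⟩
        1# + 0#
          ≈⟨ solve 2 (λ w n → con 1 :+ con 0 := con 0 :* w :+ (con 0 :* n :+ con 1 :* con 1)) refl (weight K (suc b)) (- 1#) ⟩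
        0# · weight K (suc b) + correction (suc b) 0 0 ∎
        where b≡K = Natₚ.suc-injective (≡.trans (≡.sym (Natₚ.+-identityʳ (suc b))) b+1+0≡K+1)
      Λ-base .(b Nat.+ suc r) (suc b) (suc r) ≡.refl = begin
        fromℕ R (suc b) · weight K b + v · 0#
          ≈⟨ +-cong (weight-ratio b r) (zeroʳ v) ⟩
        fromℕ R (suc r) · weight K (suc b) + 0#
          ≈⟨ +-congˡ (solve 1 (λ n → con 0 := con 0 :* n :+ con 0 :* con 1) refl (- 1#)) ⟩
        fromℕ R (suc r) · weight K (suc b) + correction (suc b) 0 (suc r) ∎
        where K = b Nat.+ suc r

      Λ-closedForm : ∀ K m a r → a Nat.+ (m Nat.+ r) ≡ suc K →
        Λ (weight K) a m ≈ fromℕ R r · binomialSum (weight K) a m + correction a m r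
      Λ-closedForm K zero    a r eq = Λ-base K a r eq
      Λ-closedForm K (suc m) a r eq =
        offset-rec (Λ-rec f a m) (fromℕ·binomialSum-rec f a m r) (correction-rec a m r)
          (Λ-closedForm K m a (suc r) (≡.trans (≡.cong (a Nat.+_) (Natₚ.+-suc m r)) eq))
          (Λ-closedForm K m (suc a) r (≡.trans (≡.sym (Natₚ.+-suc a (m Nat.+ r))) eq))
        where f = weight K

  u≈1+s·s : ∀ {p s u} → u · (1# - p) ≈ 1# → s · s · (1# - p) ≈ p → u ≈ 1# + s · s
  u≈1+s·s {p} {s} {u} u[1-p]≈1 s·s[1-p]≈p = begin
    u                            ≈⟨ *-identityʳ u ⟨
    u · 1#                       ≈⟨ *-congˡ 1-p+p≈1 ⟨
    u · ((1# - p) + p)           ≈⟨ distribˡ u _ p ⟩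
    u · (1# - p) + u · p         ≈⟨ +-cong u[1-p]≈1 (*-congˡ (sym s·s[1-p]≈p)) ⟩
    1# + u · (s · s · (1# - p))  ≈⟨ +-congˡ (solve 3 (λ u s q → u :* (s :* s :* q) := s :* s :* (u :* q)) refl u s (1# - p)) ⟩
    1# + s · s · (u · (1# - p))  ≈⟨ +-congˡ (trans (*-congˡ u[1-p]≈1) (*-identityʳ _)) ⟩
    1# + s · s                   ∎
    where
    1-p+p≈1 : (1# - p) + p ≈ 1#
    1-p+p≈1 = trans (+-assoc 1# (- p) p) (trans (+-congˡ (-‿inverseˡ p)) (+-identityʳ 1#))

  module ClosedForms {n : ℕ} (G : Graph n) (s t u : Carrier) (s·t≈1 : s · t ≈ 1#) (u≈1+s·s : u ≈ 1# + s · s)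
      (inv : ℕ → Carrier) (inv-correct : ∀ m → NonZero m → fromℕ R m · inv m ≈ 1#) where
    open GraphCounts G
    open BinomialSums u
    open GraphSums G s t u s·t≈1 u≈1+s·s
    open Telescoping u (s · s) u≈1+s·s
    open Weights inv inv-correct

    lhs-closedForm : ∀ L → Σl R (map (λ E' → pow R s (length E') · χ[_] R s t E' G) (subsets⁺ L))
                           ≈ correction 0 (nonEdges L) (edges L)
    lhs-closedForm L = begin
      Σ⁺                                   ≈⟨ +-identityˡ Σ⁺ ⟨
      0# + Σ⁺                              ≈⟨ +-congʳ (trans (+-cong (*-identityˡ (- 1#)) (*-identityˡ 1#)) (-‿inverseˡ 1#)) ⟨
      (1# · - 1# + 1# · 1#) + Σ⁺           ≈⟨ +-assoc _ _ Σ⁺ ⟩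
      1# · - 1# + (1# · 1# + Σ⁺)           ≈⟨ +-congˡ (Σl-subsets-sχ L) ⟩
      correction 0 (nonEdges L) (edges L)  ∎
      where Σ⁺ = Σl R (map (λ E' → pow R s (length E') · χ[_] R s t E' G) (subsets⁺ L))

    rhs-closedForm : ∀ x xs → let E = x ∷ xs in
      Σl R (map (λ { (e , E∖e) →
              s · χ[_] R s t (e ∷ []) G ·
              Σl R (map (λ E' →
                  inv (length E * ((length E ∸ 1) C length E')) · pow R u (length E') · noEdgeIn R E' G)
                (subsets E∖e)) })
            (picks E))
      ≈ correction 0 (nonEdges E) (edges E)
    rhs-closedForm x xs = ∙-cancelʳ (T · B m) _ _ (begin
      _ + T · B m
        ≈⟨ +-congʳ (Σl-cong (λ { (e , r) → *-cong (*-congˡ (*-identityʳ _)) (Σl-subsets-noEdgeTerm f 0 r) }) (picks E)) ⟩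
      Σl R (map (pickTerm B) (picks E)) + T · B m
        ≈⟨ Σl-picks B E ⟩
      s · s · timesPred B m
        ≈⟨ trans (+-congʳ (zeroˡ _)) (+-identityˡ _) ⟨
      Λ f 0 m
        ≈⟨ Λ-closedForm K m 0 (edges E) (nonEdges+edges E) ⟩
      T · B m + correction 0 m (edges E)
        ≈⟨ +-comm _ _ ⟩
      correction 0 m (edges E) + T · B m ∎)
      where
      E = x ∷ xs
      K = length xs
      f = weight K
      B = binomialSum f 0
      m = nonEdges E
      T = fromℕ R (edges E)

mainTheorem4 : ∀ {c ℓ : Level} (R : CommutativeRing c ℓ) →
  let open CommutativeRing R renaming (_*_ to _·_) in
  -- p ∈ R, with s = sqrt(p/(1-p)), t = sqrt((1-p)/p) (positive roots: s·t = 1),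
  -- u = 1/(1-p), and inv m = 1/m for nonzero naturals m (R is a ℚ-algebra)
  (p s t u : Carrier) (inv : ℕ → Carrier) →
  (∀ m → NonZero m → fromℕ R m · inv m ≈ 1#) →
  u · (1# - p) ≈ 1# →
  s · s · (1# - p) ≈ p →
  t · t · p ≈ 1# - p →
  s · t ≈ 1# →
  ∀ (n : ℕ) (E : List (Edge n)) → Unique E → E ≢ [] →
  ∀ (G : Graph n) →
    Σl R (map (λ E' → pow R s (length E') · χ[_] R s t E' G) (subsets⁺ E))
    ≈ Σl R (map (λ { (e , E∖e) →
          s · χ[_] R s t (e ∷ []) G ·
          Σl R (map (λ E' →
              inv (length E * ((length E ∸ 1) C length E')) · pow R u (length E') · noEdgeIn R E' G)
            (subsets E∖e)) })
        (picks E))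
mainTheorem4 R p s t u inv inv-correct u[1-p]≈1 s·s[1-p]≈p _ s·t≈1 n []       _ _ G = CommutativeRing.refl R
mainTheorem4 R p s t u inv inv-correct u[1-p]≈1 s·s[1-p]≈p _ s·t≈1 n (x ∷ xs) _ _ G =
  trans (lhs-closedForm (x ∷ xs)) (sym (rhs-closedForm x xs))
  where
  open CommutativeRing R using (trans; sym)
  open ClosedForms R G s t u s·t≈1 (u≈1+s·s R u[1-p]≈1 s·s[1-p]≈p) inv inv-correct
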